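{- Let $\mathbf t=t(0)t(1)t(2)\cdots$ be the Thue–Morse sequence. For integers $i,j\ge 0$ define $f(i,j)=t(i+j)$. Then $f$ is a frameless $2$-coloring of $\mathbb{N}\times\mathbb{N}$: there do not exist $m,n\ge 0$ and $p,q\ge 1$ such that $f(m,n+i)=f(m+p,n+i)$ for all $0\le i\le q$ and $f(m+j,n)=f(m+j,n+q)$ for all $0\le j\le p$.
   Context: The Thue–Morse sequence is defined by $t(n)=$ the number of $1$ bits in the binary representation of $n$, taken modulo $2$ (equivalently, $\mathbf t=\lim_{n\to\infty}\mu^n(0)$ for the morphism $\mu(0)=01$, $\mu(1)=10$); it begins $0110100110010110\cdots$. $\mathbb{N}=\{0,1,2,\dots\}$. A picture frame in a coloring $f$ of $\mathbb{N}\times\mathbb{N}$ is a rectangular block with at least two rows and columns whose first row equals its last row and whose first column equals its last column (as made explicit in the claim); a coloring is frameless if it has no picture frame. -}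

module Defs where

open import Data.Nat using (ℕ; zero; suc; _+_; _≤_; _%_; _/_)
open import Data.Bool using (Bool; false; true; _xor_)
open import Data.Product using (_×_; ∃-syntax)
open import Relation.Binary.PropositionalEquality using (_≡_)
open import Relation.Nullary using (¬_)

bit : ℕ → Bool
bit n with n % 2
... | zero = false
... | suc _ = true

-- parity of the number of 1 bits of n, computed with fuel k;
-- fuel n is enough since n / 2 < n for n ≥ 1 (and 0 has no 1 bits).
parityFuel : ℕ → ℕ → Bool
parityFuel zero    n = false
parityFuel (suc k) n = bit n xor parityFuel k (n / 2)

-- Thue–Morse sequence: t n = (number of 1 bits of n) mod 2, false = 0, true = 1
t : ℕ → Bool
t n = parityFuel n n

f : ℕ → ℕ → Bool
f i j = t (i + j)

PictureFrame : (ℕ → ℕ → Bool) → Set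
PictureFrame g =
  ∃[ m ] ∃[ n ] ∃[ p ] ∃[ q ]
    (1 ≤ p × 1 ≤ q
    × (∀ i → i ≤ q → g m (n + i) ≡ g (m + p) (n + i))
    × (∀ j → j ≤ p → g (m + j) n ≡ g (m + j) (n + q)))

Frameless : (ℕ → ℕ → Bool) → Set
Frameless g = ¬ PictureFrame g

-- A picture frame with sides p ≤ q gives, along its first and last rows, a factor
-- t(a) t(a+1) … t(a+2p) of the Thue–Morse word with period p (an overlap); if q ≤ p the
-- columns give one of period q. But t has no overlaps: via t(2k) = t(k) and
-- t(2k+1) = ¬ t(k), an overlap of even period 2r halves to one of period r, and in an
-- overlap of odd period p any two neighbours differ, so t(a+p) ≠ t(a).

module Submission where

open import Defs
open import Data.Bool using (Bool; true; false; not; _xor_)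
open import Data.Bool.Properties using (not-injective; ¬-not; not-¬)
open import Data.Nat
open import Data.Nat.Properties
open import Data.Nat.DivMod
open import Data.Nat.Divisibility using (m∣m*n)
open import Data.Nat.Induction using (<-rec)
open import Data.Nat.Tactic.RingSolver using (solve-∀)
open import Data.Product using (∃-syntax; _,_)
open import Data.Sum using (_⊎_; inj₁; inj₂)
open import Function using (_∘_)
open import Relation.Binary.PropositionalEquality
open import Relation.Nullary using (¬_)
open ≡-Reasoning

even-or-odd : ∀ n → (∃[ k ] n ≡ 2 * k) ⊎ (∃[ k ] n ≡ suc (2 * k))
even-or-odd zero = inj₁ (0 , refl)
even-or-odd (suc n) with even-or-odd n
... | inj₁ (k , refl) = inj₂ (k , refl)
... | inj₂ (k , refl) = inj₁ (suc k , cong suc (sym (+-suc k (k + 0))))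

2*k%2≡0 : ∀ k → 2 * k % 2 ≡ 0
2*k%2≡0 k = trans (cong (_% 2) (*-comm 2 k)) (m*n%n≡0 k 2)

2*k/2≡k : ∀ k → 2 * k / 2 ≡ k
2*k/2≡k k = trans (cong (_/ 2) (*-comm 2 k)) (m*n/n≡m k 2)

[1+2*k]%2≡1 : ∀ k → suc (2 * k) % 2 ≡ 1
[1+2*k]%2≡1 k = trans (cong (λ x → suc x % 2) (*-comm 2 k)) ([m+kn]%n≡m%n 1 k 2)

[1+2*k]/2≡k : ∀ k → suc (2 * k) / 2 ≡ k
[1+2*k]/2≡k k = trans (+-distrib-/-∣ʳ 1 {d = 2} (m∣m*n k)) (2*k/2≡k k)

n≤1+k⇒n/2≤k : ∀ {n k} → n ≤ suc k → n / 2 ≤ k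
n≤1+k⇒n/2≤k {zero}  _      = z≤n
n≤1+k⇒n/2≤k {suc n} n≤1+k = ≤-pred (≤-trans (m/n<m (suc n) 2 (s≤s (s≤s z≤n))) n≤1+k)

bit-even : ∀ n → n % 2 ≡ 0 → bit n ≡ false
bit-even _ n%2≡0 rewrite n%2≡0 = refl

bit-odd : ∀ n → n % 2 ≡ 1 → bit n ≡ true
bit-odd _ n%2≡1 rewrite n%2≡1 = refl

parityFuel-zero : ∀ k → parityFuel k 0 ≡ false
parityFuel-zero zero    = refl
parityFuel-zero (suc k) = parityFuel-zero k

parityFuel-sufficient : ∀ k l {n} → n ≤ k → n ≤ l → parityFuel k n ≡ parityFuel l n
parityFuel-sufficient zero    zero    _   _   = refl
parityFuel-sufficient zero    (suc l) z≤n _   = sym (parityFuel-zero l)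
parityFuel-sufficient (suc k) zero    _   z≤n = parityFuel-zero k
parityFuel-sufficient (suc k) (suc l) {n} n≤1+k n≤1+l =
  cong (bit n xor_) (parityFuel-sufficient k l (n≤1+k⇒n/2≤k n≤1+k) (n≤1+k⇒n/2≤k n≤1+l))

t-step : ∀ n → t n ≡ bit n xor t (n / 2)
t-step zero    = refl
t-step (suc n) =
  cong (bit (suc n) xor_) (parityFuel-sufficient n (suc n / 2) (n≤1+k⇒n/2≤k ≤-refl) ≤-refl)

t-double : ∀ k → t (2 * k) ≡ t k
t-double k = begin
  t (2 * k)                      ≡⟨ t-step (2 * k) ⟩
  bit (2 * k) xor t (2 * k / 2)  ≡⟨ cong₂ _xor_ (bit-even (2 * k) (2*k%2≡0 k)) (cong t (2*k/2≡k k)) ⟩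
  t k                            ∎

t-double-suc : ∀ k → t (suc (2 * k)) ≡ not (t k)
t-double-suc k = begin
  t (suc (2 * k))                            ≡⟨ t-step (suc (2 * k)) ⟩
  bit (suc (2 * k)) xor t (suc (2 * k) / 2)  ≡⟨ cong₂ _xor_ (bit-odd (suc (2 * k)) ([1+2*k]%2≡1 k)) (cong t ([1+2*k]/2≡k k)) ⟩
  not (t k)                                  ∎

t-2k≢t-1+2k : ∀ k → t (2 * k) ≢ t (suc (2 * k))
t-2k≢t-1+2k k eq = not-¬ refl (trans (sym (t-double k)) (trans eq (t-double-suc k)))

Overlap : ℕ → ℕ → Set
Overlap a p = ∀ i → i ≤ p → t (a + i) ≡ t (a + i + p)

double-sum : ∀ c l r → 2 * c + 2 * l + 2 * r ≡ 2 * (c + l + r)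
double-sum = solve-∀

overlap-halve : ∀ a r → Overlap a (2 * r) → ∃[ c ] Overlap c r
overlap-halve a r ov with even-or-odd a
... | inj₁ (c , refl) = c , λ l l≤r → begin
  t (c + l)                  ≡⟨ t-double (c + l) ⟨
  t (2 * (c + l))            ≡⟨ cong t (*-distribˡ-+ 2 c l) ⟩
  t (2 * c + 2 * l)          ≡⟨ ov (2 * l) (*-monoʳ-≤ 2 l≤r) ⟩
  t (2 * c + 2 * l + 2 * r)  ≡⟨ cong t (double-sum c l r) ⟩
  t (2 * (c + l + r))        ≡⟨ t-double (c + l + r) ⟩
  t (c + l + r)              ∎
... | inj₂ (c , refl) = c , λ l l≤r → not-injective (begin
  not (t (c + l))                    ≡⟨ t-double-suc (c + l) ⟨
  t (suc (2 * (c + l)))              ≡⟨ cong (t ∘ suc) (*-distribˡ-+ 2 c l) ⟩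
  t (suc (2 * c) + 2 * l)            ≡⟨ ov (2 * l) (*-monoʳ-≤ 2 l≤r) ⟩
  t (suc (2 * c) + 2 * l + 2 * r)    ≡⟨ cong (t ∘ suc) (double-sum c l r) ⟩
  t (suc (2 * (c + l + r)))          ≡⟨ t-double-suc (c + l + r) ⟩
  not (t (c + l + r))                ∎)

≢-≢⇒≡ : {x y z : Bool} → x ≢ y → y ≢ z → x ≡ z
≢-≢⇒≡ x≢y y≢z = trans (¬-not x≢y) (sym (¬-not (≢-sym y≢z)))

alternating-odd-distance : (s : ℕ → Bool) (r : ℕ) →
  (∀ j → j < suc (2 * r) → s j ≢ s (suc j)) → s 0 ≢ s (suc (2 * r))
alternating-odd-distance s zero    alternates = alternates 0 (s≤s z≤n)
alternating-odd-distance s (suc r) alternates =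
  subst (λ n → s 0 ≢ s (suc n)) (sym (*-suc 2 r))
    (subst (s 0 ≢_) (≢-≢⇒≡ (alternates′ (suc (2 * r)) (m<n⇒m<1+n (n<1+n _))) (alternates′ (2 + 2 * r) ≤-refl))
      (alternating-odd-distance s r (λ j j<1+2r → alternates′ j (m<n⇒m<1+n (m<n⇒m<1+n j<1+2r)))))
  where
  alternates′ : ∀ j → j < 3 + 2 * r → s j ≢ s (suc j)
  alternates′ j = alternates j ∘ subst (j <_) (cong suc (sym (*-suc 2 r)))

-- Since p is odd, one of a + j and a + j + p is even, and there t(2k) ≠ t(2k+1).
overlap-odd-neighbours-differ : ∀ a r → Overlap a (suc (2 * r)) →
  ∀ j → j < suc (2 * r) → t (a + j) ≢ t (a + suc j)
overlap-odd-neighbours-differ a r ov j j<p with even-or-odd (a + j)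
... | inj₁ (k , a+j≡2k) =
  subst₂ _≢_ (cong t (sym a+j≡2k)) (cong t (sym (trans (+-suc a j) (cong suc a+j≡2k)))) (t-2k≢t-1+2k k)
... | inj₂ (k , a+j≡1+2k) = λ eq → t-2k≢t-1+2k (suc (k + r)) (begin
  t (2 * suc (k + r))          ≡⟨ cong t shifted-even ⟨
  t (a + j + p)                ≡⟨ ov j (<⇒≤ j<p) ⟨
  t (a + j)                    ≡⟨ eq ⟩
  t (a + suc j)                ≡⟨ ov (suc j) j<p ⟩
  t (a + suc j + p)            ≡⟨ cong t (trans (cong (_+ p) (+-suc a j)) (cong suc shifted-even)) ⟩
  t (suc (2 * suc (k + r)))    ∎)
  where
  p = suc (2 * r)
  odd+odd : ∀ k r → suc (2 * k) + suc (2 * r) ≡ 2 * suc (k + r)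
  odd+odd = solve-∀
  shifted-even : a + j + p ≡ 2 * suc (k + r)
  shifted-even = trans (cong (_+ p) a+j≡1+2k) (odd+odd k r)

overlap-odd-impossible : ∀ a r → ¬ Overlap a (suc (2 * r))
overlap-odd-impossible a r ov =
  alternating-odd-distance (λ j → t (a + j)) r (overlap-odd-neighbours-differ a r ov)
    (trans (ov 0 z≤n) (cong (λ x → t (x + suc (2 * r))) (+-identityʳ a)))

overlap-free : ∀ p → 1 ≤ p → ∀ a → ¬ Overlap a p
overlap-free = <-rec _ step
  where
  step : ∀ p → (∀ {q} → q < p → 1 ≤ q → ∀ a → ¬ Overlap a q) → 1 ≤ p → ∀ a → ¬ Overlap a p
  step p rec 1≤p a ov with even-or-odd p
  step _ rec () a ov | inj₁ (zero , refl)
  step _ rec _  a ov | inj₁ (suc r , refl) =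
    let c , ov′ = overlap-halve a (suc r) ov in rec (m<m+n (suc r) (s≤s z≤n)) (s≤s z≤n) c ov′
  step _ rec _  a ov | inj₂ (r , refl) = overlap-odd-impossible a r ov

theorem3 : Frameless f
theorem3 (m , n , p , q , 1≤p , 1≤q , top≡bottom , left≡right) with ≤-total p q
... | inj₁ p≤q = overlap-free p 1≤p (m + n) λ i i≤p →
  subst₂ (λ x y → t x ≡ t y) (sym (+-assoc m n i)) (row-shift m n i p) (top≡bottom i (≤-trans i≤p p≤q))
  where
  row-shift : ∀ m n i p → m + p + (n + i) ≡ m + n + i + p
  row-shift = solve-∀
... | inj₂ q≤p = overlap-free q 1≤q (m + n) λ j j≤q →
  subst₂ (λ x y → t x ≡ t y) (column-start m n j) (column-shift m n j q) (left≡right j (≤-trans j≤q q≤p))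
  where
  column-start : ∀ m n j → m + j + n ≡ m + n + j
  column-start = solve-∀
  column-shift : ∀ m n j q → m + j + (n + q) ≡ m + n + j + q
  column-shift = solve-∀
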